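{- Let $k$ and $l$ be positive integers. The following two conditions are equivalent: (i) $R_k+R_l\leq R_{k+l-1}$; (ii) for all real $x,y$ with $R_{k-1}\leq x<R_k$ and $R_{l-1}\leq y<R_l$, one has $\pi_R(x+y)\leq \pi_R(x)+\pi_R(y)$.
   Context: $\pi(x)$ denotes the number of primes $\leq x$. For $n\geq1$, the $n$th Ramanujan prime $R_n$ is the smallest positive integer with the property that if $x\geq R_n$ then $\pi(x)-\pi(x/2)\geq n$; we use the convention $R_0=0$. $\pi_R(x)$ denotes the number of Ramanujan primes $\leq x$.
   Formalization: The variables x and y in condition (ii) range over the rationals instead of the reals. -}

module Defs where

open import Data.Nat using (ℕ; zero; suc; _+_; _∸_; _≤_; _/_)
open import Data.Nat.Primality using (prime?)
open import Data.List using (List; length; filter; upTo)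
open import Data.Bool.ListAction using (any)
open import Data.Product using (Σ; _×_; ∃)
open import Relation.Binary.PropositionalEquality using (_≡_)
open import Relation.Nullary.Decidable using (⌊_⌋)
import Data.Nat as ℕ
open import Data.Integer using (ℤ; +_; -[1+_])
import Data.Rational as ℚ
open import Data.Bool using (Bool; _∧_; T)
open import Data.Bool.Properties using (T?)

π : ℕ → ℕ
π x = length (filter prime? (upTo (suc x)))

-- The Ramanujan property of r for index n: every x ≥ r has π(x) - π(x/2) ≥ n.
-- (For real x, π(x) = π(⌊x⌋) and π(x/2) = π(⌊⌊x⌋/2⌋), so quantifying over ℕ suffices.)
RamProp : ℕ → ℕ → Set
RamProp n r = ∀ (x : ℕ) → r ≤ x → n ≤ π x ∸ π (x / 2)

IsRamanujan : ℕ → ℕ → Set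
IsRamanujan n r = 1 ≤ r × RamProp n r × (∀ r' → 1 ≤ r' → RamProp n r' → r ≤ r')

IsRamanujanSeq : (ℕ → ℕ) → Set
IsRamanujanSeq R = (R 0 ≡ 0) × (∀ n → IsRamanujan (suc n) (R (suc n)))

-- m is a Ramanujan prime: m = R n for some n ≥ 1 (n is searched among 1..m;
-- this bound is harmless since R n ≥ n).
isRamPrime : (ℕ → ℕ) → ℕ → Bool
isRamPrime R m = any (λ n → ⌊ 1 ℕ.≤? n ⌋ ∧ ⌊ R n ℕ.≟ m ⌋) (upTo (suc m))

πRℕ : (ℕ → ℕ) → ℕ → ℕ
πRℕ R x = length (filter (λ m → T? (isRamPrime R m)) (upTo (suc x)))

πR : (ℕ → ℕ) → ℚ.ℚ → ℕ
πR R q with ℚ.floor q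
... | + n = πRℕ R n
... | -[1+ _ ] = 0

ι : ℕ → ℚ.ℚ
ι n = (+ n) ℚ./ 1

-- Since π(x) - π(x/2) grows by at most one when x does, the Ramanujan property of index
-- n + 2 at r + 1 gives the property of index n + 1 at r; so the Ramanujan primes are
-- strictly increasing and π_R(x) = j exactly when R_j ≤ ⌊x⌋ < R_{j+1}. For x ∈ [R_{k-1}, R_k)
-- and y ∈ [R_{l-1}, R_l) we then have π_R(x) + π_R(y) = k + l - 2 and x + y < R_k + R_l,
-- so R_k + R_l ≤ R_{k+l-1} gives π_R(x + y) ≤ k + l - 2. Conversely, if R_{k+l-1} < R_k + R_l
-- then x = R_k - ½ and y = R_l - ½ satisfy x + y = R_k + R_l - 1 ≥ R_{k+l-1}, hence
-- π_R(x + y) ≥ k + l - 1.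

module Submission where

open import Defs
open import Level using (Level)
open import Data.Nat as ℕ
  using (ℕ; zero; suc; pred; _+_; _∸_; _≤_; _<_; _/_; z≤n; s≤s; _≤′_; ≤′-refl; ≤′-step; _≟_)
import Data.Nat.Properties as ℕ
import Data.Nat.DivMod as ℕ
open import Data.Nat.Coprimality as Coprime using ()
open import Data.Nat.Primality using (prime?)
open import Data.Integer as ℤ using (+_; -[1+_]; +≤+)
import Data.Integer.Properties as ℤ
import Data.Integer.DivMod as ℤ
open import Data.Rational as ℚ using (ℚ; mkℚ; ½; 0ℚ)
  renaming (_≤_ to _≤ℚ_; _<_ to _<ℚ_; _+_ to _+ℚ_)
import Data.Rational.Properties as ℚ
open import Data.List using (length; filter; upTo; _++_; [_])
import Data.List.Properties as List
open import Data.List.Relation.Unary.Any using (satisfied)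
import Data.List.Relation.Unary.Any.Properties as Any
open import Data.Bool using (Bool; T; _∧_)
open import Data.Bool.Properties using (T?; T-∧)
open import Data.Product using (_×_; ∃-syntax; _,_; proj₁; proj₂)
open import Data.Sum using (inj₁; inj₂)
open import Data.Empty using (⊥-elim)
open import Function using (_∘_)
open import Function.Bundles using (_⇔_; Equivalence; mk⇔)
open import Relation.Nullary using (¬_)
open import Relation.Nullary.Decidable using (yes; no; ⌊_⌋; toWitness; fromWitness)
open import Relation.Unary using (Pred; Decidable)
open import Algebra.Bundles using (CommutativeMonoid)
open import Algebra.Properties.CommutativeSemigroup
  (CommutativeMonoid.commutativeSemigroup ℚ.+-0-commutativeMonoid) using (interchange)
open import Relation.Binary.PropositionalEquality hiding ([_])

module _ {p : Level} {P : Pred ℕ p} (P? : Decidable P) where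

  count : ℕ → ℕ
  count n = length (filter P? (upTo n))

  count-suc : ∀ n → count (suc n) ≡ count n + length (filter P? [ n ])
  count-suc n = begin
    length (filter P? (upTo (suc n)))              ≡⟨ cong (length ∘ filter P?) (sym (List.upTo-∷ʳ n)) ⟩
    length (filter P? (upTo n ++ [ n ]))            ≡⟨ cong length (List.filter-++ P? (upTo n) [ n ]) ⟩
    length (filter P? (upTo n) ++ filter P? [ n ])  ≡⟨ List.length-++ (filter P? (upTo n)) ⟩
    count n + length (filter P? [ n ])             ∎
    where open ≡-Reasoning

  count-accept : ∀ n → P n → count (suc n) ≡ suc (count n)
  count-accept n pn = begin
    count (suc n)                        ≡⟨ count-suc n ⟩
    count n + length (filter P? [ n ])   ≡⟨ cong (λ xs → count n + length xs) (List.filter-accept P? pn) ⟩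
    count n + 1                          ≡⟨ ℕ.+-comm (count n) 1 ⟩
    suc (count n)                        ∎
    where open ≡-Reasoning

  count-reject : ∀ n → ¬ P n → count (suc n) ≡ count n
  count-reject n ¬pn = begin
    count (suc n)                        ≡⟨ count-suc n ⟩
    count n + length (filter P? [ n ])   ≡⟨ cong (λ xs → count n + length xs) (List.filter-reject P? ¬pn) ⟩
    count n + 0                          ≡⟨ ℕ.+-identityʳ (count n) ⟩
    count n                              ∎
    where open ≡-Reasoning

  count[1+n]≤1+count[n] : ∀ n → count (suc n) ≤ suc (count n)
  count[1+n]≤1+count[n] n with P? n
  ... | yes pn = ℕ.≤-reflexive (count-accept n pn)
  ... | no ¬pn = ℕ.m≤n⇒m≤1+n (ℕ.≤-reflexive (count-reject n ¬pn))

  count[n]≤count[1+n] : ∀ n → count n ≤ count (suc n)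
  count[n]≤count[1+n] n = subst (count n ≤_) (sym (count-suc n)) (ℕ.m≤m+n (count n) _)

  count-mono-≤′ : ∀ {m n} → m ≤′ n → count m ≤ count n
  count-mono-≤′ ≤′-refl = ℕ.≤-refl
  count-mono-≤′ (≤′-step m≤′n) = ℕ.≤-trans (count-mono-≤′ m≤′n) (count[n]≤count[1+n] _)

  count-mono-≤ : ∀ {m n} → m ≤ n → count m ≤ count n
  count-mono-≤ = count-mono-≤′ ∘ ℕ.≤⇒≤′

Δπ : ℕ → ℕ
Δπ x = π x ∸ π (x / 2)

suc[m]∸n≤suc[m∸n] : ∀ m n → suc m ∸ n ≤ suc (m ∸ n)
suc[m]∸n≤suc[m∸n] m       zero          = ℕ.≤-refl
suc[m]∸n≤suc[m∸n] zero    (suc zero)    = z≤n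
suc[m]∸n≤suc[m∸n] zero    (suc (suc n)) = z≤n
suc[m]∸n≤suc[m∸n] (suc m) (suc n)       = suc[m]∸n≤suc[m∸n] m n

Δπ-suc-≤ : ∀ x → Δπ (suc x) ≤ suc (Δπ x)
Δπ-suc-≤ x = ℕ.≤-trans
  (ℕ.∸-mono (count[1+n]≤1+count[n] prime? (suc x))
            (count-mono-≤ prime? (s≤s (ℕ./-monoˡ-≤ 2 (ℕ.n≤1+n x)))))
  (suc[m]∸n≤suc[m∸n] (π x) (π (x / 2)))

RamProp-weaken : ∀ {n r} → RamProp (suc n) r → RamProp n r
RamProp-weaken {n} ram x r≤x = ℕ.≤-trans (ℕ.n≤1+n n) (ram x r≤x)

RamProp-pred : ∀ {n r} → RamProp (suc n) (suc r) → RamProp n r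
RamProp-pred {n} {r} ram x r≤x with ℕ.m≤n⇒m<n∨m≡n r≤x
... | inj₁ r<x  = RamProp-weaken ram x r<x
... | inj₂ refl = ℕ.≤-pred (ℕ.≤-trans (ram (suc r) ℕ.≤-refl) (Δπ-suc-≤ r))

¬RamProp-0 : ∀ {n} → ¬ RamProp (suc n) 0
¬RamProp-0 ram with ram 0 z≤n
... | ()

IsRamanujan-< : ∀ {n a b} → IsRamanujan (suc n) a → IsRamanujan (suc (suc n)) b → a < b
IsRamanujan-< {n} {a} (_ , _ , a-least) (s≤s z≤n , ram-b , _) = s≤s (a-below _ (RamProp-pred ram-b))
  where
  a-below : ∀ r → RamProp (suc n) r → a ≤ r
  a-below zero    ram = ⊥-elim (¬RamProp-0 ram)
  a-below (suc r) ram = a-least (suc r) (s≤s z≤n) ram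

module _ (R : ℕ → ℕ) where

  private
    isRamIndex : ℕ → ℕ → Bool
    isRamIndex m n = ⌊ 1 ℕ.≤? n ⌋ ∧ ⌊ R n ≟ m ⌋

  isRamPrime⇒ : ∀ {m} → T (isRamPrime R m) → ∃[ n ] 1 ≤ n × R n ≡ m
  isRamPrime⇒ {m} isRP with satisfied (Any.any⁻ (isRamIndex m) (upTo (suc m)) isRP)
  ... | n , t = n , toWitness (proj₁ both) , toWitness (proj₂ both)
    where both = Equivalence.to (T-∧ {⌊ 1 ℕ.≤? n ⌋}) t

  ⇒isRamPrime : ∀ {m n} → n ≤ m → 1 ≤ n → R n ≡ m → T (isRamPrime R m)
  ⇒isRamPrime {m} {n} n≤m 1≤n Rn≡m = Any.any⁺ (isRamIndex m)
    (Any.applyUpTo⁺ (λ i → i) n-isIndex (s≤s n≤m))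
    where
    n-isIndex : T (isRamIndex m n)
    n-isIndex = Equivalence.from (T-∧ {⌊ 1 ℕ.≤? n ⌋}) (fromWitness 1≤n , fromWitness Rn≡m)

ι≡mkℚ : ∀ n → ι n ≡ mkℚ (+ n) 0 (Coprime.sym (Coprime.1-coprimeTo n))
ι≡mkℚ n = ℚ.normalize-coprime _

ι-+ : ∀ m n → ι m +ℚ ι n ≡ ι (m + n)
ι-+ m n rewrite ι≡mkℚ m | ι≡mkℚ n =
  cong (ℚ._/ 1) (trans (cong₂ ℤ._+_ (ℤ.*-identityʳ (+ m)) (ℤ.*-identityʳ (+ n))) (sym (ℤ.pos-+ m n)))

ι-mono-≤ : ∀ {m n} → m ≤ n → ι m ≤ℚ ι n
ι-mono-≤ {m} {n} m≤n rewrite ι≡mkℚ m | ι≡mkℚ n = ℚ.*≤* (ℤ.*-monoʳ-≤-nonNeg (+ 1) (+≤+ m≤n))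

justBelow : ℕ → ℚ
justBelow m = ι (pred m) +ℚ ½

<⇒ι≤justBelow : ∀ {j m} → j < m → ι j ≤ℚ justBelow m
<⇒ι≤justBelow {j} {m} j<m = begin
  ι j               ≤⟨ ι-mono-≤ (ℕ.<⇒≤pred j<m) ⟩
  ι (pred m)        ≡⟨ ℚ.+-identityʳ (ι (pred m)) ⟨
  ι (pred m) +ℚ 0ℚ  ≤⟨ ℚ.+-monoʳ-≤ (ι (pred m)) (ℚ.*≤* (+≤+ z≤n)) ⟩
  justBelow m       ∎
  where open ℚ.≤-Reasoning

justBelow<ι : ∀ {m} → 1 ≤ m → justBelow m <ℚ ι m
justBelow<ι {suc m} _ = begin-strict
  ι m +ℚ ½     <⟨ ℚ.+-monoʳ-< (ι m) (ℚ.*<* (ℤ.+<+ (s≤s (s≤s z≤n)))) ⟩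
  ι m +ℚ ι 1   ≡⟨ ι-+ m 1 ⟩
  ι (m + 1)    ≡⟨ cong ι (ℕ.+-comm m 1) ⟩
  ι (suc m)    ∎
  where open ℚ.≤-Reasoning

justBelow-+ : ∀ {m n} → 1 ≤ m → 1 ≤ n → justBelow m +ℚ justBelow n ≡ ι (pred (m + n))
justBelow-+ {suc m} {suc n} _ _ = begin
  (ι m +ℚ ½) +ℚ (ι n +ℚ ½)  ≡⟨ interchange (ι m) ½ (ι n) ½ ⟩
  (ι m +ℚ ι n) +ℚ (½ +ℚ ½)  ≡⟨ cong (_+ℚ ι 1) (ι-+ m n) ⟩
  ι (m + n) +ℚ ι 1          ≡⟨ ι-+ (m + n) 1 ⟩
  ι (m + n + 1)             ≡⟨ cong ι (trans (ℕ.+-comm (m + n) 1) (sym (ℕ.+-suc m n))) ⟩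
  ι (m + suc n)             ∎
  where open ≡-Reasoning

floor*↧≤↥ : ∀ q → ℚ.floor q ℤ.* ℚ.↧ q ℤ.≤ ℚ.↥ q
floor*↧≤↥ (mkℚ i d _) = ℤ.[n/d]*d≤n i (+ suc d)

↥<[1+floor]*↧ : ∀ q → ℚ.↥ q ℤ.< ℤ.suc (ℚ.floor q) ℤ.* ℚ.↧ q
↥<[1+floor]*↧ (mkℚ i d _) =
  subst (λ f → i ℤ.< ℤ.suc f ℤ.* + suc d) (sym (ℤ.div-pos-is-/ℕ i (suc d))) (ℤ.n<s[n/ℕd]*d i (suc d))

ι≤⇒≤floor : ∀ {n} q → ι n ≤ℚ q → + n ℤ.≤ ℚ.floor q
ι≤⇒≤floor {n} q@record{} n≤q rewrite ι≡mkℚ n =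
  subst (+ n ℤ.≤_) (ℤ.pred-suc (ℚ.floor q)) (ℤ.i<j⇒i≤pred[j]
    (ℤ.*-cancelʳ-<-nonNeg {+ n} {ℤ.suc (ℚ.floor q)} (ℚ.↧ q) (ℤ.≤-<-trans n*↧≤↥ (↥<[1+floor]*↧ q))))
  where
  n*↧≤↥ : + n ℤ.* ℚ.↧ q ℤ.≤ ℚ.↥ q
  n*↧≤↥ = subst (+ n ℤ.* ℚ.↧ q ℤ.≤_) (ℤ.*-identityʳ (ℚ.↥ q)) (ℚ.drop-*≤* n≤q)

<ι⇒floor< : ∀ {n} q → q <ℚ ι n → ℚ.floor q ℤ.< + n
<ι⇒floor< {n} q@record{} q<n rewrite ι≡mkℚ n =
  ℤ.*-cancelʳ-<-nonNeg (ℚ.↧ q) (ℤ.≤-<-trans (floor*↧≤↥ q) ↥<n*↧)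
  where
  ↥<n*↧ : ℚ.↥ q ℤ.< + n ℤ.* ℚ.↧ q
  ↥<n*↧ = subst (ℤ._< + n ℤ.* ℚ.↧ q) (ℤ.*-identityʳ (ℚ.↥ q)) (ℚ.drop-*<* q<n)

module RamanujanSequence (R : ℕ → ℕ) (isSeq : IsRamanujanSeq R) where

  R-pos : ∀ n → 1 ≤ R (suc n)
  R-pos n = proj₁ (proj₂ isSeq n)

  R-<-suc : ∀ n → R n < R (suc n)
  R-<-suc zero    = subst (_< R 1) (sym (proj₁ isSeq)) (R-pos 0)
  R-<-suc (suc n) = IsRamanujan-< (proj₂ isSeq n) (proj₂ isSeq (suc n))

  R-mono-≤′ : ∀ {i j} → i ≤′ j → R i ≤ R j
  R-mono-≤′ ≤′-refl          = ℕ.≤-refl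
  R-mono-≤′ (≤′-step i≤′j) = ℕ.≤-trans (R-mono-≤′ i≤′j) (ℕ.<⇒≤ (R-<-suc _))

  R-mono-≤ : ∀ {i j} → i ≤ j → R i ≤ R j
  R-mono-≤ = R-mono-≤′ ∘ ℕ.≤⇒≤′

  R-mono-< : ∀ {i j} → i < j → R i < R j
  R-mono-< i<j = ℕ.<-≤-trans (R-<-suc _) (R-mono-≤ i<j)

  R-cancel-≤ : ∀ {i j} → R i ≤ R j → i ≤ j
  R-cancel-≤ Ri≤Rj = ℕ.≮⇒≥ (λ j<i → ℕ.<⇒≱ (R-mono-< j<i) Ri≤Rj)

  R-cancel-< : ∀ {i j} → R i < R j → i < j
  R-cancel-< Ri<Rj = ℕ.≰⇒> (λ j≤i → ℕ.<⇒≱ Ri<Rj (R-mono-≤ j≤i))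

  n≤R[n] : ∀ n → n ≤ R n
  n≤R[n] zero    = z≤n
  n≤R[n] (suc n) = ℕ.≤-<-trans (n≤R[n] n) (R-<-suc n)

  ¬isRamPrime-0 : ¬ T (isRamPrime R 0)
  ¬isRamPrime-0 isRP with isRamPrime⇒ R {0} isRP
  ... | suc n , _ , Rn≡0 = ℕ.<⇒≢ (R-pos n) (sym Rn≡0)

  isRamPrime-in-gap : ∀ {j m} → T (isRamPrime R m) → R j ≤ m → m < R (suc j) → R j ≡ m
  isRamPrime-in-gap {j} {m} isRP Rj≤m m<R[1+j] with isRamPrime⇒ R {m} isRP
  ... | n , _ , refl = cong R (ℕ.≤-antisym (R-cancel-≤ Rj≤m) (ℕ.≤-pred (R-cancel-< m<R[1+j])))

  πRℕ-gap : ∀ {j} m → R j ≤ m → m < R (suc j) → πRℕ R m ≡ j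
  πRℕ-gap {zero}  zero    _    _ = count-reject (T? ∘ isRamPrime R) 0 ¬isRamPrime-0
  πRℕ-gap {suc j} zero    Rj≤0 _ = ⊥-elim (ℕ.<⇒≱ (R-pos j) Rj≤0)
  πRℕ-gap {j}     (suc m) Rj≤m m<R[1+j] with R j ≟ suc m
  πRℕ-gap {zero}  (suc m) _ _ | yes R0≡1+m = ⊥-elim (ℕ.0≢1+n (trans (sym (proj₁ isSeq)) R0≡1+m))
  πRℕ-gap {suc j} (suc m) _ _ | yes Rj≡1+m = begin
    count (T? ∘ isRamPrime R) (suc (suc m))  ≡⟨ count-accept (T? ∘ isRamPrime R) (suc m) isRP ⟩
    suc (πRℕ R m)                           ≡⟨ cong suc (πRℕ-gap m R[j]≤m (ℕ.≤-reflexive (sym Rj≡1+m))) ⟩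
    suc j                                   ∎
    where
    open ≡-Reasoning
    isRP : T (isRamPrime R (suc m))
    isRP = ⇒isRamPrime R (ℕ.≤-trans (n≤R[n] (suc j)) (ℕ.≤-reflexive Rj≡1+m)) (s≤s z≤n) Rj≡1+m
    R[j]≤m : R j ≤ m
    R[j]≤m = ℕ.≤-pred (subst (R j <_) Rj≡1+m (R-<-suc j))
  ... | no Rj≢1+m = begin
    count (T? ∘ isRamPrime R) (suc (suc m))  ≡⟨ count-reject (T? ∘ isRamPrime R) (suc m) ¬isRP ⟩
    πRℕ R m                                 ≡⟨ πRℕ-gap m R[j]≤m (ℕ.<-trans (ℕ.n<1+n m) m<R[1+j]) ⟩
    j                                       ∎
    where
    open ≡-Reasoning
    ¬isRP : ¬ T (isRamPrime R (suc m))
    ¬isRP isRP = Rj≢1+m (isRamPrime-in-gap isRP Rj≤m m<R[1+j])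
    R[j]≤m : R j ≤ m
    R[j]≤m = ℕ.≤-pred (ℕ.≤∧≢⇒< Rj≤m Rj≢1+m)

  gap-containing : ∀ m → ∃[ j ] R j ≤ m × m < R (suc j)
  gap-containing zero = 0 , ℕ.≤-reflexive (proj₁ isSeq) , R-pos 0
  gap-containing (suc m) with gap-containing m
  ... | j , Rj≤m , m<R[1+j] with ℕ.m≤n⇒m<n∨m≡n m<R[1+j]
  ...   | inj₁ 1+m<R[1+j] = j , ℕ.m≤n⇒m≤1+n Rj≤m , 1+m<R[1+j]
  ...   | inj₂ 1+m≡R[1+j] = suc j , ℕ.≤-reflexive (sym 1+m≡R[1+j]) ,
                             subst (_< R (suc (suc j))) (sym 1+m≡R[1+j]) (R-<-suc (suc j))

  ≤πRℕ : ∀ {j m} → R j ≤ m → j ≤ πRℕ R m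
  ≤πRℕ {j} {m} Rj≤m with gap-containing m
  ... | i , Ri≤m , m<R[1+i] =
    subst (j ≤_) (sym (πRℕ-gap m Ri≤m m<R[1+i])) (ℕ.≤-pred (R-cancel-< (ℕ.≤-<-trans Rj≤m m<R[1+i])))

  πRℕ≤ : ∀ {j m} → m < R (suc j) → πRℕ R m ≤ j
  πRℕ≤ {j} {m} m<R[1+j] with gap-containing m
  ... | i , Ri≤m , m<R[1+i] =
    subst (_≤ j) (sym (πRℕ-gap m Ri≤m m<R[1+i])) (ℕ.≤-pred (R-cancel-< (ℕ.≤-<-trans Ri≤m m<R[1+j])))

  ≤πR : ∀ {j q} → ι (R j) ≤ℚ q → j ≤ πR R q
  ≤πR {j} {q} Rj≤q with ℚ.floor q | ι≤⇒≤floor q Rj≤q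
  ... | + m | +≤+ Rj≤m = ≤πRℕ Rj≤m

  πR≤ : ∀ {j q} → q <ℚ ι (R (suc j)) → πR R q ≤ j
  πR≤ {j} {q} q<R[1+j] with ℚ.floor q | <ι⇒floor< q q<R[1+j]
  ... | + m      | ℤ.+<+ m<R[1+j] = πRℕ≤ m<R[1+j]
  ... | -[1+ _ ] | _              = z≤n

  πR-SubadditiveOn : ℕ → ℕ → Set
  πR-SubadditiveOn k l = ∀ (x y : ℚ) → ι (R k) ≤ℚ x → x <ℚ ι (R (suc k)) →
    ι (R l) ≤ℚ y → y <ℚ ι (R (suc l)) → πR R (x +ℚ y) ≤ πR R x + πR R y

  R-sum≤⇒πR-subadditive : ∀ k l → R (suc k) + R (suc l) ≤ R (suc (k + l)) → πR-SubadditiveOn k l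
  R-sum≤⇒πR-subadditive k l sum≤ x y Rk≤x x<R[1+k] Rl≤y y<R[1+l] = begin
    πR R (x +ℚ y)    ≤⟨ πR≤ x+y<R[1+k+l] ⟩
    k + l            ≤⟨ ℕ.+-mono-≤ (≤πR Rk≤x) (≤πR Rl≤y) ⟩
    πR R x + πR R y  ∎
    where
    open ℕ.≤-Reasoning
    x+y<R[1+k+l] : x +ℚ y <ℚ ι (R (suc (k + l)))
    x+y<R[1+k+l] = ℚ.<-≤-trans (ℚ.+-mono-< x<R[1+k] y<R[1+l])
      (subst (_≤ℚ ι (R (suc (k + l)))) (sym (ι-+ (R (suc k)) (R (suc l)))) (ι-mono-≤ sum≤))

  πR-subadditive⇒R-sum≤ : ∀ k l → πR-SubadditiveOn k l → R (suc k) + R (suc l) ≤ R (suc (k + l))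
  πR-subadditive⇒R-sum≤ k l subadditive = ℕ.≮⇒≥ (ℕ.n≮n (k + l) ∘ k+l<k+l)
    where
    x = justBelow (R (suc k))
    y = justBelow (R (suc l))
    x<R[1+k] : x <ℚ ι (R (suc k))
    x<R[1+k] = justBelow<ι (R-pos k)
    y<R[1+l] : y <ℚ ι (R (suc l))
    y<R[1+l] = justBelow<ι (R-pos l)
    R[k]≤x : ι (R k) ≤ℚ x
    R[k]≤x = <⇒ι≤justBelow (R-<-suc k)
    R[l]≤y : ι (R l) ≤ℚ y
    R[l]≤y = <⇒ι≤justBelow (R-<-suc l)
    k+l<k+l : R (suc (k + l)) < R (suc k) + R (suc l) → k + l < k + l
    k+l<k+l R[1+k+l]<sum = begin-strict
      k + l            <⟨ ≤πR R[1+k+l]≤x+y ⟩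
      πR R (x +ℚ y)    ≤⟨ subadditive x y R[k]≤x x<R[1+k] R[l]≤y y<R[1+l] ⟩
      πR R x + πR R y  ≤⟨ ℕ.+-mono-≤ (πR≤ x<R[1+k]) (πR≤ y<R[1+l]) ⟩
      k + l            ∎
      where
      open ℕ.≤-Reasoning
      R[1+k+l]≤x+y : ι (R (suc (k + l))) ≤ℚ x +ℚ y
      R[1+k+l]≤x+y = subst (ι (R (suc (k + l))) ≤ℚ_) (sym (justBelow-+ (R-pos k) (R-pos l)))
        (ι-mono-≤ (ℕ.<⇒≤pred R[1+k+l]<sum))

lemma3 : (R : ℕ → ℕ) → IsRamanujanSeq R → (k l : ℕ) → 1 ≤ k → 1 ≤ l →
    ((R k + R l ≤ R (k + l ∸ 1))
      ⇔ (∀ (x y : ℚ) → ι (R (k ∸ 1)) ≤ℚ x → x <ℚ ι (R k) →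
           ι (R (l ∸ 1)) ≤ℚ y → y <ℚ ι (R l) →
           πR R (x +ℚ y) ≤ πR R x + πR R y))
lemma3 R isSeq (suc k) (suc l) _ _ rewrite ℕ.+-suc k l =
  mk⇔ (R-sum≤⇒πR-subadditive k l) (πR-subadditive⇒R-sum≤ k l)
  where open RamanujanSequence R isSeq
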